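{- For every unsatisfiable clause-set $F$ we have $\mathrm{whd}(F)\le\mathrm{ss}(F)$.
   Context: Literals are variables $v$ or negations $\overline{v}$; clauses are finite sets of literals without complementary pair; clause-sets are finite sets of clauses; $\bot$ empty clause, $\top$ empty clause-set, $c(F)$ number of clauses. A partial assignment $\varphi$ maps finitely many variables to $\{0,1\}$; $\varphi*F$ removes satisfied clauses and false literals. $F$ is satisfiable iff $\varphi*F=\top$ for some $\varphi$; $F\models G$ iff every $\varphi$ with $\varphi*F=\top$ has $\varphi*G=\top$. Resolution: clauses $C,D$ with exactly one clashing literal $x\in C,\overline{x}\in D$ have resolvent $(C\cup D)\setminus\{x,\overline{x}\}$. A resolution tree is a finite rooted tree, inner nodes with exactly two children, nodes labelled by clauses, each inner label the resolvent of its children's labels; a refutation of $F$ has leaf labels in $F$ and root label $\bot$. Asymmetric width: $\mathrm{whd}(T)=0$ for a single node; otherwise, with root children labelled $C_1,C_2$ and subtrees $T_1,T_2$, $\mathrm{whd}(T)=\max(\mathrm{whd}(T_1),\mathrm{whd}(T_2),\min(|C_1|,|C_2|))$; $\mathrm{whd}(F)$ is the minimum over refutations of $F$. Semantic $k$-sequence for $F$: $F_1,\dots,F_p$ with $c(F_i)\le k$, $F_1=\top$, and each $F_i$ ($i\ge2$) obtained either by $F_{i-1}\models F_i$ or as $F_{i-1}\cup\{C\}$ with $C\in F$; complete if $F_p$ is unsatisfiable. $\mathrm{ss}(F)$ is the least $k\in\mathbb{N}$ admitting a complete semantic $k$-sequence for $F$. -}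

module Defs where

open import Data.Nat using (ℕ; zero; suc; _≤_; _⊔_; _⊓_)
open import Data.Bool using (Bool; true; false; not)
import Data.Bool as B
import Data.Nat as N
open import Data.Product using (Σ; _×_; _,_; ∃; ∃-syntax; proj₁; proj₂)
open import Data.Product.Properties using (≡-dec)
open import Data.Sum using (_⊎_)
open import Data.List using (List; []; _∷_; length; map; filter)
open import Data.List.Relation.Unary.All using (All)
open import Data.List.Relation.Unary.Any using (Any; any?)
open import Data.List.Relation.Unary.Unique.Propositional using (Unique)
open import Data.List.Relation.Unary.AllPairs using (AllPairs)
open import Relation.Binary.PropositionalEquality using (_≡_; _≢_)
open import Relation.Binary.Definitions using (DecidableEquality)
open import Relation.Nullary using (¬_)
open import Relation.Nullary.Decidable using (¬?)
open import Function.Bundles using (_⇔_)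

-- A literal is a variable (a natural number) with a sign:
-- (v , true) is the positive literal v, (v , false) is its negation.
Lit : Set
Lit = ℕ × Bool

_≟L_ : DecidableEquality Lit
_≟L_ = ≡-dec N._≟_ B._≟_

open import Data.List.Membership.DecPropositional _≟L_ public
  using (_∈_; _∉_; _∈?_)

compl : Lit → Lit
compl (v , b) = (v , not b)

IsClause : List Lit → Set
IsClause C = Unique C × (∀ l → l ∈ C → compl l ∉ C)

⊥ᶜ : List Lit
⊥ᶜ = []

_≋_ : List Lit → List Lit → Set
C ≋ D = ∀ l → (l ∈ C) ⇔ (l ∈ D)

ClauseSet : Set
ClauseSet = List (List Lit)

_∈ₛ_ : List Lit → ClauseSet → Set
C ∈ₛ F = Any (λ D → C ≋ D) F

IsClauseSet : ClauseSet → Set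
IsClauseSet F = All IsClause F × AllPairs (λ C D → ¬ (C ≋ D)) F

⊤ᶜˢ : ClauseSet
⊤ᶜˢ = []

c : ClauseSet → ℕ
c = length

-- A partial assignment is represented by the finite consistent set of
-- literals it makes true (the literal (v , b) ∈ φ means φ(v) = b).
IsPAss : List Lit → Set
IsPAss φ = ∀ l → l ∈ φ → compl l ∉ φ

_*_ : List Lit → ClauseSet → ClauseSet
φ * F = map (filter (λ l → ¬? (compl l ∈? φ)))
            (filter (λ C → ¬? (any? (λ l → l ∈? φ) C)) F)

Satisfiable : ClauseSet → Set
Satisfiable F = Σ (List Lit) λ φ → IsPAss φ × (φ * F ≡ ⊤ᶜˢ)

Unsatisfiable : ClauseSet → Set
Unsatisfiable F = ¬ Satisfiable F

_⊨_ : ClauseSet → ClauseSet → Set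
F ⊨ G = ∀ φ → IsPAss φ → φ * F ≡ ⊤ᶜˢ → φ * G ≡ ⊤ᶜˢ

IsResolvent : List Lit → List Lit → List Lit → Set
IsResolvent C D R =
  Σ Lit λ x → (x ∈ C) × (compl x ∈ D)
    × (∀ y → y ∈ C → compl y ∈ D → y ≡ x)
    × (∀ l → (l ∈ R) ⇔ ((l ∈ C ⊎ l ∈ D) × l ≢ x × l ≢ compl x))

data Tree : Set where
  leaf : List Lit → Tree
  node : List Lit → Tree → Tree → Tree

label : Tree → List Lit
label (leaf C) = C
label (node C _ _) = C

WellFormed : Tree → Set
WellFormed (leaf C) = IsClause C
WellFormed (node C T₁ T₂) =
  IsClause C × IsResolvent (label T₁) (label T₂) C
    × WellFormed T₁ × WellFormed T₂

LeavesIn : ClauseSet → Tree → Set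
LeavesIn F (leaf C) = C ∈ₛ F
LeavesIn F (node _ T₁ T₂) = LeavesIn F T₁ × LeavesIn F T₂

IsRefutation : ClauseSet → Tree → Set
IsRefutation F T = WellFormed T × LeavesIn F T × (label T ≡ ⊥ᶜ)

whd : Tree → ℕ
whd (leaf _) = 0
whd (node _ T₁ T₂) =
  whd T₁ ⊔ whd T₂ ⊔ (length (label T₁) ⊓ length (label T₂))

IsUnionWith : ClauseSet → ClauseSet → List Lit → Set
IsUnionWith G H C = ∀ D → (D ∈ₛ G) ⇔ ((D ∈ₛ H) ⊎ (D ≋ C))

data SemSeq (F : ClauseSet) (k : ℕ) : ClauseSet → Set where
  start  : SemSeq F k ⊤ᶜˢ
  entail : ∀ {G H} → SemSeq F k G → IsClauseSet H → c H ≤ k →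
           G ⊨ H → SemSeq F k H
  add    : ∀ {G H C} → SemSeq F k G → IsClauseSet H → c H ≤ k →
           C ∈ₛ F → IsUnionWith H G C → SemSeq F k H

CompleteSemSeq : ClauseSet → ℕ → Set
CompleteSemSeq F k = Σ ClauseSet λ G → SemSeq F k G × Unsatisfiable G

IsSS : ClauseSet → ℕ → Set
IsSS F s = CompleteSemSeq F s × (∀ k → CompleteSemSeq F k → s ≤ k)

-- Walk a complete semantic k-sequence F₁ = ⊤, …, Fₚ backwards, keeping the invariant:
-- every consistent partial assignment φ satisfying Fᵢ falsifies the root clause of some
-- resolution tree from F of asymmetric width ≤ k. It holds vacuously for the unsatisfiable
-- Fₚ and passes through entailment steps unchanged. For a step Fᵢ = Fᵢ₋₁ ∪ {C} with C
-- not satisfied by φ, resolve C successively with trees for φ ∪ {u}, u ∈ C. Such a tree can be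
-- taken for a sub-assignment of φ ∪ {u} choosing one satisfied literal per clause of Fᵢ, so
-- its root clause, being falsified by at most k literals, has length ≤ k; hence each
-- resolution step has a side of length ≤ k. At F₁ = ⊤ the empty assignment gives a refutation.
module Submission where

open import Defs
open import Data.Bool using (true; false)
open import Data.Bool.Properties using (not-involutive)
open import Data.Empty using (⊥-elim)
open import Data.List using (List; []; _∷_; [_]; length; map; filter; _++_)
open import Data.List.Properties using (length-map; filter-none; filter-some; filter-notAll)
open import Data.List.Membership.Propositional using (find; lose)
open import Data.List.Membership.Propositional.Properties
  using (∈-++⁺ˡ; ∈-++⁺ʳ; ∈-++⁻; ∈-map⁺; ∈-map⁻; ∈-filter⁺; ∈-filter⁻)
open import Data.List.Relation.Binary.Subset.Propositional using (_⊆_)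
open import Data.List.Relation.Unary.All as All using (All; []; _∷_)
open import Data.List.Relation.Unary.Any as Any using (Any; here; there; any?)
open import Data.List.Relation.Unary.AllPairs using (_∷_)
open import Data.List.Relation.Unary.Unique.Propositional using (Unique)
import Data.List.Relation.Unary.Unique.Propositional.Properties as Unique
open import Data.Nat using (ℕ; _≤_; _<_; z≤n; s≤s; _⊔_; _⊓_)
open import Data.Nat.Properties using (≤-trans; <-irrefl; ⊔-lub; m⊓n≤n)
open import Data.Product using (Σ; _×_; _,_; proj₁; proj₂)
open import Data.Sum using (_⊎_; inj₁; inj₂; [_,_]′; map₂)
open import Function using (_∘_; id)
open import Function.Bundles using (_⇔_; mk⇔; Equivalence)
open import Relation.Binary.Definitions using (DecidableEquality)
open import Relation.Binary.PropositionalEquality using (_≡_; _≢_; refl; sym; trans; cong; subst)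
open import Relation.Nullary using (¬_; Dec; yes; no)
open import Relation.Nullary.Decidable using (¬?; _×-dec_; decidable-stable)

unique-length-≤ : {A : Set} → DecidableEquality A →
  ∀ {xs ys : List A} → Unique xs → xs ⊆ ys → length xs ≤ length ys
unique-length-≤ _≟_ {[]} _ _ = z≤n
unique-length-≤ _≟_ {x ∷ xs} {ys} (x∉xs ∷ xs-unique) x∷xs⊆ys =
  ≤-trans (s≤s (unique-length-≤ _≟_ xs-unique xs⊆ys-x))
          (filter-notAll ≢x? ys (Any.map (λ x≡y y≢x → y≢x (sym x≡y)) (x∷xs⊆ys (here refl))))
  where
  ≢x? = λ y → ¬? (y ≟ x)
  xs⊆ys-x : xs ⊆ filter ≢x? ys
  xs⊆ys-x y∈xs = ∈-filter⁺ ≢x? (x∷xs⊆ys (there y∈xs)) (λ y≡x → All.lookup x∉xs y∈xs (sym y≡x))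

compl-involutive : ∀ l → compl (compl l) ≡ l
compl-involutive (v , b) = cong (v ,_) (not-involutive b)

compl-injective : ∀ {l m} → compl l ≡ compl m → l ≡ m
compl-injective {l} {m} eq =
  trans (sym (compl-involutive l)) (trans (cong compl eq) (compl-involutive m))

compl-swap : ∀ {l m} → compl l ≡ m → l ≡ compl m
compl-swap {l} eq = trans (sym (compl-involutive l)) (cong compl eq)

compl-≢ : ∀ l → compl l ≢ l
compl-≢ (v , true) ()
compl-≢ (v , false) ()

compl²-∈⁺ : ∀ {l xs} → l ∈ xs → compl (compl l) ∈ xs
compl²-∈⁺ {l} = subst (_∈ _) (sym (compl-involutive l))

compl²-∈⁻ : ∀ {l xs} → compl (compl l) ∈ xs → l ∈ xs
compl²-∈⁻ {l} = subst (_∈ _) (compl-involutive l)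

∈-map-compl⁻ : ∀ {l D} → l ∈ map compl D → compl l ∈ D
∈-map-compl⁻ l∈ with ∈-map⁻ compl l∈
... | m , m∈D , refl = compl²-∈⁺ m∈D

Sat : List Lit → List Lit → Set
Sat φ D = Any (_∈ φ) D

sat? : ∀ φ D → Dec (Sat φ D)
sat? φ D = any? (_∈? φ) D

sat-≋ : ∀ {φ D E} → D ≋ E → Sat φ E → Sat φ D
sat-≋ D≋E E-sat with find E-sat
... | l , l∈E , l∈φ = lose (Equivalence.from (D≋E l) l∈E) l∈φ

sat-∈ₛ : ∀ {φ D G} → All (Sat φ) G → D ∈ₛ G → Sat φ D
sat-∈ₛ G-sat D∈G with find D∈G
... | E , E∈G , D≋E = sat-≋ D≋E (All.lookup G-sat E∈G)

sat-union : ∀ {φ G H C} → IsUnionWith H G C → All (Sat φ) G → Sat φ C → All (Sat φ) H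
sat-union H≈G∪C G-sat C-sat = All.tabulate λ {D} D∈H →
  [ sat-∈ₛ G-sat , (λ D≋C → sat-≋ D≋C C-sat) ]′
    (Equivalence.to (H≈G∪C D) (lose D∈H (λ l → mk⇔ id id)))

*-≡⊤ : ∀ {φ G} → All (Sat φ) G → φ * G ≡ ⊤ᶜˢ
*-≡⊤ {φ} G-sat = cong (map _) (filter-none (¬? ∘ sat? φ) (All.map (λ sat unsat → unsat sat) G-sat))

*-≡⊤⁻ : ∀ {φ} G → φ * G ≡ ⊤ᶜˢ → All (Sat φ) G
*-≡⊤⁻ {φ} G eq = All.tabulate λ {D} D∈G → decidable-stable (sat? φ D) λ D-unsat →
  <-irrefl refl (subst (0 <_) (trans (sym (length-map (filter (λ l → ¬? (compl l ∈? φ))) (filter (¬? ∘ sat? φ) G)))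
                                   (cong length eq))
                       (filter-some (¬? ∘ sat? φ) (lose D∈G D-unsat)))

IsPAss-⊆ : ∀ {φ ψ} → ψ ⊆ φ → IsPAss φ → IsPAss ψ
IsPAss-⊆ ψ⊆φ φ-pass l l∈ψ compl-l∈ψ = φ-pass l (ψ⊆φ l∈ψ) (ψ⊆φ compl-l∈ψ)

IsPAss-[_] : ∀ u → IsPAss [ u ]
IsPAss-[ u ] l (here refl) (here eq) = compl-≢ l eq

IsPAss-++ : ∀ {φ ψ} → IsPAss φ → IsPAss ψ → (∀ {l} → l ∈ φ → compl l ∉ ψ) → IsPAss (φ ++ ψ)
IsPAss-++ {φ} φ-pass ψ-pass disjoint l l∈ compl-l∈ with ∈-++⁻ φ l∈ | ∈-++⁻ φ compl-l∈
... | inj₁ a | inj₁ b = φ-pass l a b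
... | inj₁ a | inj₂ b = disjoint a b
... | inj₂ a | inj₁ b = disjoint b (compl²-∈⁺ a)
... | inj₂ a | inj₂ b = ψ-pass l a b

Falsified : List Lit → List Lit → Set
Falsified φ D = ∀ {l} → l ∈ D → compl l ∈ φ

falsified-¬sat : ∀ {φ D} → IsPAss φ → Falsified φ D → ¬ Sat φ D
falsified-¬sat φ-pass D-false D-sat with find D-sat
... | l , l∈D , l∈φ = φ-pass l l∈φ (D-false l∈D)

falsified-length : ∀ {φ D} → IsClause D → Falsified φ D → length D ≤ length φ
falsified-length {φ} {D} (D-unique , _) D-false =
  subst (_≤ length φ) (length-map compl D)
    (unique-length-≤ _≟L_ (Unique.map⁺ compl-injective D-unique) map-compl⊆φ)
  where
  map-compl⊆φ : map compl D ⊆ φ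
  map-compl⊆φ l∈ with ∈-map⁻ compl l∈
  ... | m , m∈D , refl = D-false m∈D

falsified-[] : ∀ {D} → Falsified [] D → D ≡ []
falsified-[] {[]} _ = refl
falsified-[] {l ∷ D} D-false with D-false (here refl)
... | ()

falsifying-extension : ∀ {φ D} → IsPAss φ → IsClause D → ¬ Sat φ D → IsPAss (φ ++ map compl D)
falsifying-extension {φ} {D} φ-pass (_ , D-no-pair) D-unsat =
  IsPAss-++ φ-pass map-compl-pass (λ l∈φ compl-l∈ → D-unsat (lose (compl²-∈⁻ (∈-map-compl⁻ compl-l∈)) l∈φ))
  where
  map-compl-pass : IsPAss (map compl D)
  map-compl-pass l l∈ compl-l∈ = D-no-pair (compl l) (∈-map-compl⁻ l∈) (∈-map-compl⁻ compl-l∈)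

⊨-preserves-sat : ∀ {φ G H} → IsPAss φ → All IsClause H → G ⊨ H → All (Sat φ) G → All (Sat φ) H
⊨-preserves-sat {φ} {G} {H} φ-pass H-clauses G⊨H G-sat = All.tabulate λ {D} D∈H →
  decidable-stable (sat? φ D) λ D-unsat →
    let χ-pass = falsifying-extension φ-pass (All.lookup H-clauses D∈H) D-unsat
        χ-sat-G = *-≡⊤ (All.map (Any.map ∈-++⁺ˡ) G-sat)
    in falsified-¬sat χ-pass (∈-++⁺ʳ φ ∘ ∈-map⁺ compl)
         (All.lookup (*-≡⊤⁻ H (G⊨H _ χ-pass χ-sat-G)) D∈H)

satisfying-sublist : ∀ {φ H} → All (Sat φ) H →
  Σ (List Lit) λ ψ → ψ ⊆ φ × length ψ ≤ length H × All (Sat ψ) H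
satisfying-sublist [] = [] , (λ ()) , z≤n , []
satisfying-sublist (D-sat ∷ H-sat) with find D-sat | satisfying-sublist H-sat
... | l , l∈D , l∈φ | ψ , ψ⊆φ , ψ-length , H-sat′ =
  l ∷ ψ , (λ { (here refl) → l∈φ ; (there m) → ψ⊆φ m }) , s≤s ψ-length ,
  lose l∈D (here refl) ∷ All.map (Any.map there) H-sat′

Avoids : Lit → Lit → Set
Avoids u l = l ≢ u × l ≢ compl u

avoids? : ∀ u l → Dec (Avoids u l)
avoids? u l = ¬? (l ≟L u) ×-dec ¬? (l ≟L compl u)

resolve : Lit → List Lit → List Lit → List Lit
resolve u R D = filter (avoids? u) R ++ filter (λ l → ¬? (l ∈? R) ×-dec avoids? u l) D

resolve-∈ : ∀ u R D l → (l ∈ resolve u R D) ⇔ ((l ∈ R ⊎ l ∈ D) × l ≢ u × l ≢ compl u)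
resolve-∈ u R D l = mk⇔ to from
  where
  to : l ∈ resolve u R D → (l ∈ R ⊎ l ∈ D) × l ≢ u × l ≢ compl u
  to l∈ with ∈-++⁻ (filter (avoids? u) R) l∈
  ... | inj₁ a = let l∈R , avoids = ∈-filter⁻ (avoids? u) {xs = R} a in inj₁ l∈R , avoids
  ... | inj₂ b = let l∈D , _ , avoids = ∈-filter⁻ (λ l → ¬? (l ∈? R) ×-dec avoids? u l) {xs = D} b
                 in inj₂ l∈D , avoids
  from : (l ∈ R ⊎ l ∈ D) × l ≢ u × l ≢ compl u → l ∈ resolve u R D
  from (inj₁ l∈R , avoids) = ∈-++⁺ˡ (∈-filter⁺ (avoids? u) l∈R avoids)
  from (inj₂ l∈D , avoids) with l ∈? R
  ... | yes l∈R = ∈-++⁺ˡ (∈-filter⁺ (avoids? u) l∈R avoids)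
  ... | no l∉R = ∈-++⁺ʳ (filter (avoids? u) R)
                   (∈-filter⁺ (λ l → ¬? (l ∈? R) ×-dec avoids? u l) l∈D (l∉R , avoids))

resolve-unique : ∀ u {R D} → Unique R → Unique D → Unique (resolve u R D)
resolve-unique u {R} {D} R-unique D-unique =
  Unique.++⁺ (Unique.filter⁺ (avoids? u) R-unique) (Unique.filter⁺ D-part? D-unique)
    (λ (a , b) → proj₁ (proj₂ (∈-filter⁻ D-part? {xs = D} b)) (proj₁ (∈-filter⁻ (avoids? u) {xs = R} a)))
  where
  D-part? = λ l → ¬? (l ∈? R) ×-dec avoids? u l

label-isClause : ∀ T → WellFormed T → IsClause (label T)
label-isClause (leaf C) wf = wf
label-isClause (node C _ _) wf = proj₁ wf

module NarrowResolution (F : ClauseSet) (k : ℕ) where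

  Narrow : Tree → Set
  Narrow T = WellFormed T × LeavesIn F T × whd T ≤ k

  Refuted : List Lit → Set
  Refuted φ = Σ Tree λ T → Narrow T × Falsified φ (label T)

  ShortlyRefuted : List Lit → Set
  ShortlyRefuted φ = Σ Tree λ T → (Narrow T × Falsified φ (label T)) × length (label T) ≤ k

  ModelsRefuted : ClauseSet → Set
  ModelsRefuted G = ∀ φ → IsPAss φ → All (Sat φ) G → Refuted φ

  short-refutation : ∀ {H φ} → ModelsRefuted H → c H ≤ k → IsPAss φ → All (Sat φ) H →
    ShortlyRefuted φ
  short-refutation H-refuted H-small φ-pass H-sat with satisfying-sublist H-sat
  ... | ψ , ψ⊆φ , ψ-length , H-sat′ with H-refuted ψ (IsPAss-⊆ ψ⊆φ φ-pass) H-sat′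
  ... | T , T-narrow@(T-wf , _) , T-false =
    T , (T-narrow , ψ⊆φ ∘ T-false) ,
    ≤-trans (falsified-length (label-isClause T T-wf) T-false) (≤-trans ψ-length H-small)

  models-refuted-⊨ : ∀ {G H} → All IsClause H → G ⊨ H → ModelsRefuted H → ModelsRefuted G
  models-refuted-⊨ H-clauses G⊨H H-refuted φ φ-pass G-sat =
    H-refuted φ φ-pass (⊨-preserves-sat φ-pass H-clauses G⊨H G-sat)

  module Elimination {φ C : List Lit} (φ-pass : IsPAss φ) (C-clause : IsClause C)
    (C-unsat : ¬ Sat φ C)
    (refute-extension : ∀ {u} → u ∈ C → compl u ∉ φ → ShortlyRefuted (u ∷ φ)) where

    FalseOrIn : List Lit → Lit → Set
    FalseOrIn E l = compl l ∈ φ ⊎ l ∈ E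

    Within : List Lit → List Lit → Set
    Within E D = ∀ {l} → l ∈ D → FalseOrIn E l

    false-or-in-C-consistent : ∀ {l} → FalseOrIn C l → ¬ FalseOrIn C (compl l)
    false-or-in-C-consistent (inj₁ a) (inj₁ b) = φ-pass _ (compl²-∈⁻ b) a
    false-or-in-C-consistent (inj₁ a) (inj₂ b) = C-unsat (lose b a)
    false-or-in-C-consistent (inj₂ a) (inj₁ b) = C-unsat (lose a (compl²-∈⁻ b))
    false-or-in-C-consistent (inj₂ a) (inj₂ b) = proj₂ C-clause _ a b

    false-or-in-pop : ∀ {u E l} → (l ≡ u → compl u ∈ φ) → FalseOrIn (u ∷ E) l → FalseOrIn E l
    false-or-in-pop _ (inj₁ x) = inj₁ x
    false-or-in-pop u-false (inj₂ (here refl)) = inj₁ (u-false refl)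
    false-or-in-pop _ (inj₂ (there l∈E)) = inj₂ l∈E

    falsified-without : ∀ {u D} → Falsified (u ∷ φ) D → compl u ∉ D → Falsified φ D
    falsified-without D-false compl-u∉D l∈D with D-false l∈D
    ... | here eq = ⊥-elim (compl-u∉D (subst (_∈ _) (compl-swap eq) l∈D))
    ... | there compl-l∈φ = compl-l∈φ

    -- Literals of T are false under φ or in C, and so are those of Tu other than compl u; such
    -- literals never form a complementary pair, which excludes a second clash and makes the
    -- resolvent a clause.
    resolve-narrow : ∀ {u E} → u ∷ E ⊆ C → (T Tu : Tree) → Narrow T → Narrow Tu →
      Within (u ∷ E) (label T) → Falsified (u ∷ φ) (label Tu) → length (label Tu) ≤ k →
      u ∈ label T → compl u ∈ label Tu → Σ Tree λ T′ → Narrow T′ × Within E (label T′)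
    resolve-narrow {u} {E} u∷E⊆C T Tu (T-wf , T-leaves , T-whd) (Tu-wf , Tu-leaves , Tu-whd)
                   T-within Tu-false Tu-short u∈R compl-u∈D =
      node R′ T Tu , (R′-wf , (T-leaves , Tu-leaves) , R′-whd) , R′-within
      where
      R = label T
      D = label Tu
      R′ = resolve u R D
      R′-within : Within E R′
      R′-within l∈R′ with Equivalence.to (resolve-∈ u R D _) l∈R′
      ... | inj₁ l∈R , l≢u , _ = false-or-in-pop (⊥-elim ∘ l≢u) (T-within l∈R)
      ... | inj₂ l∈D , _ , l≢compl-u with Tu-false l∈D
      ...   | here eq = ⊥-elim (l≢compl-u (compl-swap eq))
      ...   | there compl-l∈φ = inj₁ compl-l∈φ
      unique-clash : ∀ y → y ∈ R → compl y ∈ D → y ≡ u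
      unique-clash y y∈R compl-y∈D with Tu-false compl-y∈D
      ... | here eq = trans (sym (compl-involutive y)) eq
      ... | there y∈φ = ⊥-elim (false-or-in-C-consistent (map₂ u∷E⊆C (T-within y∈R)) (inj₁ y∈φ))
      R′-clause : IsClause R′
      R′-clause = resolve-unique u (proj₁ (label-isClause T T-wf)) (proj₁ (label-isClause Tu Tu-wf)) ,
        λ m m∈R′ compl-m∈R′ → false-or-in-C-consistent
          (map₂ (u∷E⊆C ∘ there) (R′-within m∈R′)) (map₂ (u∷E⊆C ∘ there) (R′-within compl-m∈R′))
      R′-wf : WellFormed (node R′ T Tu)
      R′-wf = R′-clause , (u , u∈R , compl-u∈D , unique-clash , resolve-∈ u R D) , T-wf , Tu-wf
      R′-whd : whd T ⊔ whd Tu ⊔ (length R ⊓ length D) ≤ k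
      R′-whd = ⊔-lub (⊔-lub T-whd Tu-whd) (≤-trans (m⊓n≤n (length R) (length D)) Tu-short)

    eliminate : ∀ {u E} → u ∷ E ⊆ C → (T : Tree) → Narrow T → Within (u ∷ E) (label T) →
      Σ Tree λ T′ → Narrow T′ × Within E (label T′)
    eliminate {u} u∷E⊆C T T-narrow T-within with u ∈? label T | compl u ∈? φ
    ... | no u∉R | _ =
      T , T-narrow , λ l∈R → false-or-in-pop (λ { refl → ⊥-elim (u∉R l∈R) }) (T-within l∈R)
    ... | yes _ | yes compl-u∈φ = T , T-narrow , false-or-in-pop (λ _ → compl-u∈φ) ∘ T-within
    ... | yes u∈R | no compl-u∉φ with refute-extension (u∷E⊆C (here refl)) compl-u∉φ
    ...   | Tu , (Tu-narrow , Tu-false) , Tu-short with compl u ∈? label Tu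
    ...     | no compl-u∉D = Tu , Tu-narrow , inj₁ ∘ falsified-without Tu-false compl-u∉D
    ...     | yes compl-u∈D =
      resolve-narrow u∷E⊆C T Tu T-narrow Tu-narrow T-within Tu-false Tu-short u∈R compl-u∈D

    eliminate-all : ∀ {E} → E ⊆ C → (T : Tree) → Narrow T → Within E (label T) → Refuted φ
    eliminate-all {[]} _ T T-narrow T-within = T , T-narrow , [ id , (λ ()) ]′ ∘ T-within
    eliminate-all {u ∷ E} u∷E⊆C T T-narrow T-within with eliminate u∷E⊆C T T-narrow T-within
    ... | T′ , T′-narrow , T′-within = eliminate-all (u∷E⊆C ∘ there) T′ T′-narrow T′-within

  models-refuted-add : ∀ {G H C} → All IsClause F → c H ≤ k → C ∈ₛ F → IsUnionWith H G C →
    ModelsRefuted H → ModelsRefuted G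
  models-refuted-add F-clauses H-small C∈F H≈G∪C H-refuted φ φ-pass G-sat with find C∈F
  ... | C′ , C′∈F , C≋C′ with sat? φ C′
  ...   | yes C′-sat = H-refuted φ φ-pass (sat-union H≈G∪C G-sat (sat-≋ C≋C′ C′-sat))
  ...   | no C′-unsat =
    Elimination.eliminate-all φ-pass C′-clause C′-unsat refute-extension id
      (leaf C′) (C′-clause , lose C′∈F (λ l → mk⇔ id id) , z≤n) inj₂
    where
    C′-clause : IsClause C′
    C′-clause = All.lookup F-clauses C′∈F
    refute-extension : ∀ {u} → u ∈ C′ → compl u ∉ φ → ShortlyRefuted (u ∷ φ)
    refute-extension {u} u∈C′ compl-u∉φ =
      short-refutation H-refuted H-small
        (IsPAss-++ IsPAss-[ u ] φ-pass λ { (here refl) → compl-u∉φ })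
        (sat-union H≈G∪C (All.map (Any.map there) G-sat) (sat-≋ C≋C′ (lose u∈C′ (here refl))))

  refutation-from-sequence : ∀ {G} → IsClauseSet F → SemSeq F k G → ModelsRefuted G → Refuted []
  refutation-from-sequence _ start ⊤-refuted = ⊤-refuted [] (λ _ ()) []
  refutation-from-sequence F-set (entail seq H-set _ G⊨H) H-refuted =
    refutation-from-sequence F-set seq (models-refuted-⊨ (proj₁ H-set) G⊨H H-refuted)
  refutation-from-sequence F-set (add seq _ H-small C∈F H≈G∪C) H-refuted =
    refutation-from-sequence F-set seq (models-refuted-add (proj₁ F-set) H-small C∈F H≈G∪C H-refuted)

theorem6p3 : (F : ClauseSet) → IsClauseSet F → Unsatisfiable F →
    (s : ℕ) → IsSS F s →
    Σ Tree λ T → IsRefutation F T × (whd T ≤ s)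
theorem6p3 F F-set _ s ((G , seq , G-unsat) , _)
  with NarrowResolution.refutation-from-sequence F s F-set seq
         (λ φ φ-pass G-sat → ⊥-elim (G-unsat (φ , φ-pass , *-≡⊤ G-sat)))
... | T , (T-wf , T-leaves , T-whd) , T-false = T , (T-wf , T-leaves , falsified-[] T-false) , T-whd
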